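{- Let $0<|q|<1$. For integers $r,s$ and $n\ge0$ define $$T_{r,n}(s)=\sum_{k=0}^n\frac{(q^{ -2n};q^2)_k}{(q;q)_k(q^{1+r-n};q)_k}q^{(2-s)k}.$$ Then for every integer $n\ge0$ and integer $r$ with $(q^{1+r-n};q)_n\neq0$ and $1+q^{r+n}\ne0$, $$T_{r,n}(1)=\frac{(-q^{1+r};q)_n}{(q^{1+r-n};q)_n}(-1)^nq^{ -n^2},\qquad T_{r,n}(0)=\frac{q^n+q^r}{1+q^{r+n}}\cdot\frac{(-q^{1+r};q)_n}{(q^{1+r-n};q)_n}(-1)^nq^{ -n^2+n}.$$
   Context: For $x\in\mathbb{C}$ and integers $k\ge0$: $(x;q)_k=\prod_{j=0}^{k-1}(1-xq^j)$, and $(x;q^2)_k=\prod_{j=0}^{k-1}(1-xq^{2j})$. -}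

module Defs where

open import Level using (Level; _⊔_)
open import Data.Nat using (ℕ; zero; suc)
open import Data.Integer using (ℤ; +_; -[1+_])
open import Relation.Nullary using (¬_)
open import Algebra.Bundles using (CommutativeRing)

record Field (c ℓ : Level) : Set (Level.suc (c ⊔ ℓ)) where
  field
    commutativeRing : CommutativeRing c ℓ
  open CommutativeRing commutativeRing public
  field
    _⁻¹       : Carrier → Carrier
    ⁻¹-cong   : ∀ {x y} → x ≈ y → x ⁻¹ ≈ y ⁻¹
    0⁻¹       : 0# ⁻¹ ≈ 0#
    inverseʳ  : ∀ x → ¬ (x ≈ 0#) → x * x ⁻¹ ≈ 1#
    1≉0       : ¬ (1# ≈ 0#)

  infixl 7 _/_
  _/_ : Carrier → Carrier → Carrier
  x / y = x * y ⁻¹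

  _^ℕ_ : Carrier → ℕ → Carrier
  x ^ℕ zero  = 1#
  x ^ℕ suc n = x * x ^ℕ n

  _^ℤ_ : Carrier → ℤ → Carrier
  x ^ℤ (+ n)      = x ^ℕ n
  x ^ℤ (-[1+ n ]) = (x ⁻¹) ^ℕ suc n

  poch : Carrier → Carrier → ℕ → Carrier
  poch x b zero    = 1#
  poch x b (suc k) = poch x b k * (1# - x * b ^ℕ k)

  sumTo : ℕ → (ℕ → Carrier) → Carrier
  sumTo zero    f = f 0
  sumTo (suc n) f = sumTo n f + f (suc n)

open import Data.Integer as ℤ using ()

module _ {c ℓ} (F : Field c ℓ) where
  open Field F

  T : (q : Carrier) (r : ℤ) (n : ℕ) (s : ℤ) → Carrier
  T q r n s = sumTo n (λ k →
      poch (q ^ℤ (ℤ.- (+ 2 ℤ.* + n))) (q ^ℕ 2) k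
        / (poch q q k * poch (q ^ℤ (+ 1 ℤ.+ r ℤ.- + n)) q k)
        * q ^ℤ ((+ 2 ℤ.- s) ℤ.* + k))

{-# OPTIONS --safe #-}
-- Writing A = q⁻ⁿ and C = q^(1+r-n), we have (q⁻²ⁿ; q²)_k = (A; q)_k (-A; q)_k, so
-- T_{r,n}(s) is the terminating series ₂φ₁(A, -A; C; q, q^(2-s)). For s = 1 it is summed by
-- q-Chu–Vandermonde, proved by induction on n from the contiguous relation that trades A for A q.
-- For s = 0, writing q^k = 1 - (1 - q^k) and cancelling 1 - q^k against (q; q)_k expresses the
-- series as a q-Chu–Vandermonde sum minus a multiple of one whose parameters are all multiplied by q.
module Submission where

open import Defs
open import Algebra.Bundles using (CommutativeRing; RawRing)
import Algebra.Solver.Ring.AlmostCommutativeRing as ACR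
open import Data.Nat as ℕ using (ℕ; zero; suc; _≤_; s≤s; _≤′_; ≤′-refl; ≤′-step)
import Data.Nat.Properties as ℕP
open import Data.Integer as ℤ using (ℤ; +_; -[1+_])
import Data.Integer.Properties as ℤP
open import Data.Sign as Sign using (Sign)
open import Data.Maybe using (Maybe; just; nothing)
open import Data.Product using (_×_; _,_)
open import Function using (id; _∘_)
open import Relation.Nullary using (¬_; yes; no)
open import Relation.Binary.PropositionalEquality as P using (_≡_)

-- The standard ring solver normalises polynomials over a coefficient ring with decidable
-- equality; taking ℤ, which maps into every commutative ring, lets it cancel terms like x - x.
module IntegerCoefficientRingSolver {c ℓ} (R : CommutativeRing c ℓ) where
  open CommutativeRing R
  open import Algebra.Properties.Semiring.Mult.TCOptimised semiring
    using (×-homo-+; ×1-homo-*; 1+×) renaming (_×_ to _×ᵐ_)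
  open import Algebra.Properties.Ring ring using (-1*x≈-x)
  open import Algebra.Properties.AbelianGroup +-abelianGroup using (⁻¹-∙-comm)
  open import Algebra.Properties.Group +-group using (⁻¹-involutive; ε⁻¹≈ε)
  open import Algebra.Properties.CommutativeSemigroup *-commutativeSemigroup using (interchange)
  open import Relation.Binary.Reasoning.Setoid setoid

  ℤ-rawRing : RawRing _ _
  ℤ-rawRing = record
    { Carrier = ℤ ; _≈_ = _≡_ ; _+_ = ℤ._+_ ; _*_ = ℤ._*_ ; -_ = ℤ.-_ ; 0# = ℤ.0ℤ ; 1# = ℤ.1ℤ }

  ⟦_⟧ℤ : ℤ → Carrier
  ⟦ + n ⟧ℤ      = n ×ᵐ 1#
  ⟦ -[1+ n ] ⟧ℤ = - (suc n ×ᵐ 1#)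

  ⟦_⟧ₛ : Sign → Carrier
  ⟦ Sign.+ ⟧ₛ = 1#
  ⟦ Sign.- ⟧ₛ = - 1#

  1+x-[1+y]≈x-y : ∀ x y → (1# + x) - (1# + y) ≈ x - y
  1+x-[1+y]≈x-y x y = begin
    (1# + x) - (1# + y)      ≈⟨ +-cong (+-comm 1# x) (sym (⁻¹-∙-comm 1# y)) ⟩
    (x + 1#) + (- 1# + - y)  ≈⟨ +-assoc x 1# _ ⟩
    x + (1# + (- 1# + - y))  ≈⟨ +-congˡ (+-assoc 1# (- 1#) (- y)) ⟨
    x + ((1# - 1#) + - y)    ≈⟨ +-congˡ (+-congʳ (-‿inverseʳ 1#)) ⟩
    x + (0# + - y)           ≈⟨ +-congˡ (+-identityˡ (- y)) ⟩
    x - y                    ∎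

  ⟦⊖⟧ : ∀ m n → ⟦ m ℤ.⊖ n ⟧ℤ ≈ ⟦ + m ⟧ℤ - ⟦ + n ⟧ℤ
  ⟦⊖⟧ m       zero    = sym (trans (+-congˡ ε⁻¹≈ε) (+-identityʳ _))
  ⟦⊖⟧ zero    (suc n) = sym (+-identityˡ _)
  ⟦⊖⟧ (suc m) (suc n) = begin
    ⟦ suc m ℤ.⊖ suc n ⟧ℤ               ≡⟨ P.cong ⟦_⟧ℤ (ℤP.[1+m]⊖[1+n]≡m⊖n m n) ⟩
    ⟦ m ℤ.⊖ n ⟧ℤ                       ≈⟨ ⟦⊖⟧ m n ⟩
    ⟦ + m ⟧ℤ - ⟦ + n ⟧ℤ                ≈⟨ 1+x-[1+y]≈x-y ⟦ + m ⟧ℤ ⟦ + n ⟧ℤ ⟨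
    (1# + ⟦ + m ⟧ℤ) - (1# + ⟦ + n ⟧ℤ)  ≈⟨ +-cong (1+× m 1#) (-‿cong (1+× n 1#)) ⟨
    ⟦ + suc m ⟧ℤ - ⟦ + suc n ⟧ℤ        ∎

  ⟦⟧-+-homo : ∀ i j → ⟦ i ℤ.+ j ⟧ℤ ≈ ⟦ i ⟧ℤ + ⟦ j ⟧ℤ
  ⟦⟧-+-homo (+ m)    (+ n)    = ×-homo-+ 1# m n
  ⟦⟧-+-homo (+ m)    -[1+ n ] = ⟦⊖⟧ m (suc n)
  ⟦⟧-+-homo -[1+ m ] (+ n)    = trans (⟦⊖⟧ n (suc m)) (+-comm _ _)
  ⟦⟧-+-homo -[1+ m ] -[1+ n ] = begin
    - (suc (suc (m ℕ.+ n)) ×ᵐ 1#)    ≡⟨ P.cong (λ k → - (k ×ᵐ 1#)) (ℕP.+-suc (suc m) n) ⟨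
    - ((suc m ℕ.+ suc n) ×ᵐ 1#)      ≈⟨ -‿cong (×-homo-+ 1# (suc m) (suc n)) ⟩
    - (⟦ + suc m ⟧ℤ + ⟦ + suc n ⟧ℤ)  ≈⟨ ⁻¹-∙-comm _ _ ⟨
    ⟦ -[1+ m ] ⟧ℤ + ⟦ -[1+ n ] ⟧ℤ    ∎

  ⟦⟧-◃ : ∀ s n → ⟦ s ℤ.◃ n ⟧ℤ ≈ ⟦ s ⟧ₛ * ⟦ + n ⟧ℤ
  ⟦⟧-◃ s      zero    = sym (zeroʳ _)
  ⟦⟧-◃ Sign.+ (suc n) = sym (*-identityˡ _)
  ⟦⟧-◃ Sign.- (suc n) = sym (-1*x≈-x _)

  ⟦⟧-sign-abs : ∀ i → ⟦ i ⟧ℤ ≈ ⟦ ℤ.sign i ⟧ₛ * ⟦ + ℤ.∣ i ∣ ⟧ℤ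
  ⟦⟧-sign-abs (+ n)    = sym (*-identityˡ _)
  ⟦⟧-sign-abs -[1+ n ] = sym (-1*x≈-x _)

  ⟦⟧ₛ-*-homo : ∀ s t → ⟦ s Sign.* t ⟧ₛ ≈ ⟦ s ⟧ₛ * ⟦ t ⟧ₛ
  ⟦⟧ₛ-*-homo Sign.+ t      = sym (*-identityˡ _)
  ⟦⟧ₛ-*-homo Sign.- Sign.+ = sym (*-identityʳ _)
  ⟦⟧ₛ-*-homo Sign.- Sign.- = trans (sym (⁻¹-involutive 1#)) (sym (-1*x≈-x _))

  ⟦⟧-*-homo : ∀ i j → ⟦ i ℤ.* j ⟧ℤ ≈ ⟦ i ⟧ℤ * ⟦ j ⟧ℤ
  ⟦⟧-*-homo i j = begin
    ⟦ (s Sign.* t) ℤ.◃ (m ℕ.* n) ⟧ℤ            ≈⟨ ⟦⟧-◃ (s Sign.* t) (m ℕ.* n) ⟩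
    ⟦ s Sign.* t ⟧ₛ * ⟦ + (m ℕ.* n) ⟧ℤ         ≈⟨ *-cong (⟦⟧ₛ-*-homo s t) (×1-homo-* m n) ⟩
    (⟦ s ⟧ₛ * ⟦ t ⟧ₛ) * (⟦ + m ⟧ℤ * ⟦ + n ⟧ℤ)  ≈⟨ interchange _ _ _ _ ⟩
    (⟦ s ⟧ₛ * ⟦ + m ⟧ℤ) * (⟦ t ⟧ₛ * ⟦ + n ⟧ℤ)  ≈⟨ *-cong (⟦⟧-sign-abs i) (⟦⟧-sign-abs j) ⟨
    ⟦ i ⟧ℤ * ⟦ j ⟧ℤ                            ∎
    where
    s t : Sign
    s = ℤ.sign i
    t = ℤ.sign j
    m n : ℕ
    m = ℤ.∣ i ∣
    n = ℤ.∣ j ∣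

  ⟦⟧-‿homo : ∀ i → ⟦ ℤ.- i ⟧ℤ ≈ - ⟦ i ⟧ℤ
  ⟦⟧-‿homo (+ zero)  = sym ε⁻¹≈ε
  ⟦⟧-‿homo (+ suc n) = refl
  ⟦⟧-‿homo -[1+ n ]  = sym (⁻¹-involutive _)

  homomorphism : ℤ-rawRing ACR.-Raw-AlmostCommutative⟶ ACR.fromCommutativeRing R
  homomorphism = record
    { ⟦_⟧ = ⟦_⟧ℤ ; +-homo = ⟦⟧-+-homo ; *-homo = ⟦⟧-*-homo ; -‿homo = ⟦⟧-‿homo
    ; 0-homo = refl ; 1-homo = refl }

  ⟦⟧-≟ : ∀ i j → Maybe (⟦ i ⟧ℤ ≈ ⟦ j ⟧ℤ)
  ⟦⟧-≟ i j with i ℤ.≟ j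
  ... | yes P.refl = just refl
  ... | no _       = nothing

  open import Algebra.Solver.Ring ℤ-rawRing (ACR.fromCommutativeRing R) homomorphism ⟦⟧-≟ public

  :0 :1 : ∀ {n} → Polynomial n
  :0 = con (+ 0)
  :1 = con (+ 1)

module FieldProperties {c ℓ} (F : Field c ℓ) where
  open Field F
  open IntegerCoefficientRingSolver commutativeRing using (solve; _:=_; _:+_; _:*_; _:-_; :-_; :1)
  open import Algebra.Properties.Semiring.Exp semiring using (_^_; ^-homo-*; ^-assocʳ)
  open import Algebra.Properties.CommutativeSemiring.Exp commutativeSemiring using (^-distrib-*)
  open import Relation.Binary.Reasoning.Setoid setoid

  private variable
    x y z : Carrier

  *≉0⇒≉0ˡ : x * y ≉ 0# → x ≉ 0#
  *≉0⇒≉0ˡ xy≉0 x≈0 = xy≉0 (trans (*-congʳ x≈0) (zeroˡ _))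

  *≉0⇒≉0ʳ : x * y ≉ 0# → y ≉ 0#
  *≉0⇒≉0ʳ xy≉0 y≈0 = xy≉0 (trans (*-congˡ y≈0) (zeroʳ _))

  inverseˡ : x ≉ 0# → x ⁻¹ * x ≈ 1#
  inverseˡ {x} x≉0 = trans (*-comm (x ⁻¹) x) (inverseʳ x x≉0)

  x≈x*y*y⁻¹ : y ≉ 0# → x ≈ x * y * y ⁻¹
  x≈x*y*y⁻¹ {y} {x} y≉0 = begin
    x               ≈⟨ *-identityʳ x ⟨
    x * 1#          ≈⟨ *-congˡ (inverseʳ y y≉0) ⟨
    x * (y * y ⁻¹)  ≈⟨ *-assoc x y (y ⁻¹) ⟨
    x * y * y ⁻¹    ∎

  *-cancelʳ : z ≉ 0# → x * z ≈ y * z → x ≈ y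
  *-cancelʳ {z} {x} {y} z≉0 xz≈yz = begin
    x             ≈⟨ x≈x*y*y⁻¹ z≉0 ⟩
    x * z * z ⁻¹  ≈⟨ *-congʳ xz≈yz ⟩
    y * z * z ⁻¹  ≈⟨ x≈x*y*y⁻¹ z≉0 ⟨
    y             ∎

  *≈⇒≈/ : y ≉ 0# → x * y ≈ z → x ≈ z / y
  *≈⇒≈/ {y} y≉0 xy≈z = trans (x≈x*y*y⁻¹ y≉0) (*-congʳ xy≈z)

  *-≉0 : x ≉ 0# → y ≉ 0# → x * y ≉ 0#
  *-≉0 {x} {y} x≉0 y≉0 xy≈0 = y≉0 (begin
    y             ≈⟨ x≈x*y*y⁻¹ x≉0 ⟩
    y * x * x ⁻¹  ≈⟨ *-congʳ (trans (*-comm y x) xy≈0) ⟩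
    0# * x ⁻¹     ≈⟨ zeroˡ (x ⁻¹) ⟩
    0#            ∎)

  ⁻¹-unique : x ≉ 0# → x * y ≈ 1# → y ≈ x ⁻¹
  ⁻¹-unique {x} {y} x≉0 xy≈1 =
    *-cancelʳ x≉0 (trans (*-comm y x) (trans xy≈1 (sym (inverseˡ x≉0))))

  ⁻¹-distrib-* : x ≉ 0# → y ≉ 0# → (x * y) ⁻¹ ≈ x ⁻¹ * y ⁻¹
  ⁻¹-distrib-* {x} {y} x≉0 y≉0 = sym (⁻¹-unique (*-≉0 x≉0 y≉0) (begin
    x * y * (x ⁻¹ * y ⁻¹)  ≈⟨ solve 4 (λ x y x⁻¹ y⁻¹ → x :* y :* (x⁻¹ :* y⁻¹) := x :* x⁻¹ :* (y :* y⁻¹))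
                                      refl x y (x ⁻¹) (y ⁻¹) ⟩
    x * x ⁻¹ * (y * y ⁻¹)  ≈⟨ *-cong (inverseʳ x x≉0) (inverseʳ y y≉0) ⟩
    1# * 1#                ≈⟨ *-identityˡ 1# ⟩
    1#                     ∎))

  1⁻¹≈1 : 1# ⁻¹ ≈ 1#
  1⁻¹≈1 = sym (⁻¹-unique 1≉0 (*-identityˡ 1#))

  ^ℕ≡^ : ∀ x n → x ^ℕ n ≡ x ^ n
  ^ℕ≡^ x zero    = P.refl
  ^ℕ≡^ x (suc n) = P.cong (x *_) (^ℕ≡^ x n)

  ^ℕ-cong : ∀ n → x ≈ y → x ^ℕ n ≈ y ^ℕ n
  ^ℕ-cong zero    x≈y = refl
  ^ℕ-cong (suc n) x≈y = *-cong x≈y (^ℕ-cong n x≈y)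

  ^ℕ-homo-* : ∀ x m n → x ^ℕ (m ℕ.+ n) ≈ x ^ℕ m * x ^ℕ n
  ^ℕ-homo-* x m n rewrite ^ℕ≡^ x (m ℕ.+ n) | ^ℕ≡^ x m | ^ℕ≡^ x n = ^-homo-* x m n

  ^ℕ-distrib-* : ∀ x y n → (x * y) ^ℕ n ≈ x ^ℕ n * y ^ℕ n
  ^ℕ-distrib-* x y n rewrite ^ℕ≡^ (x * y) n | ^ℕ≡^ x n | ^ℕ≡^ y n = ^-distrib-* x y n

  ^ℕ-assocʳ : ∀ x m n → (x ^ℕ m) ^ℕ n ≈ x ^ℕ (m ℕ.* n)
  ^ℕ-assocʳ x m n rewrite ^ℕ≡^ x m | ^ℕ≡^ (x ^ m) n | ^ℕ≡^ x (m ℕ.* n) = ^-assocʳ x m n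

  ^ℕ-double : ∀ x n → x ^ℕ (2 ℕ.* n) ≈ x ^ℕ n * x ^ℕ n
  ^ℕ-double x n = trans (^ℕ-homo-* x n (n ℕ.+ 0)) (*-congˡ (reflexive (P.cong (x ^ℕ_) (ℕP.+-identityʳ n))))

  ^ℕ-inverse : ∀ n → x * y ≈ 1# → x ^ℕ n * y ^ℕ n ≈ 1#
  ^ℕ-inverse zero    xy≈1 = *-identityˡ 1#
  ^ℕ-inverse {x} {y} (suc n) xy≈1 = begin
    x * x ^ℕ n * (y * y ^ℕ n)  ≈⟨ solve 4 (λ x y xⁿ yⁿ → x :* xⁿ :* (y :* yⁿ) := x :* y :* (xⁿ :* yⁿ))
                                          refl x y (x ^ℕ n) (y ^ℕ n) ⟩
    x * y * (x ^ℕ n * y ^ℕ n)  ≈⟨ *-cong xy≈1 (^ℕ-inverse n xy≈1) ⟩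
    1# * 1#                    ≈⟨ *-identityˡ 1# ⟩
    1#                         ∎

  ^ℤ-neg : ∀ x n → x ^ℤ (ℤ.- (+ n)) ≡ (x ⁻¹) ^ℕ n
  ^ℤ-neg x zero    = P.refl
  ^ℤ-neg x (suc n) = P.refl

  module _ (x≉0 : x ≉ 0#) where

    ^ℤ-suc : ∀ i → x ^ℤ (i ℤ.+ + 1) ≈ x ^ℤ i * x
    ^ℤ-suc (+ m)        = trans (^ℕ-homo-* x m 1) (*-congˡ (*-identityʳ x))
    ^ℤ-suc -[1+ zero ]  = trans (sym (inverseˡ x≉0)) (*-congʳ (sym (*-identityʳ (x ⁻¹))))
    ^ℤ-suc -[1+ suc m ] = begin
      (x ⁻¹) ^ℕ suc m                ≈⟨ *-identityˡ _ ⟨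
      1# * (x ⁻¹) ^ℕ suc m           ≈⟨ *-congʳ (inverseˡ x≉0) ⟨
      x ⁻¹ * x * (x ⁻¹) ^ℕ suc m     ≈⟨ solve 3 (λ x⁻¹ x y → x⁻¹ :* x :* y := x⁻¹ :* y :* x)
                                              refl (x ⁻¹) x ((x ⁻¹) ^ℕ suc m) ⟩
      x ⁻¹ * (x ⁻¹) ^ℕ suc m * x     ∎

    ^ℤ-+ : ∀ i n → x ^ℤ (i ℤ.+ + n) ≈ x ^ℤ i * x ^ℕ n
    ^ℤ-+ i zero    = begin
      x ^ℤ (i ℤ.+ + 0)  ≡⟨ P.cong (x ^ℤ_) (ℤP.+-identityʳ i) ⟩
      x ^ℤ i            ≈⟨ *-identityʳ (x ^ℤ i) ⟨
      x ^ℤ i * 1#       ∎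
    ^ℤ-+ i (suc n) = begin
      x ^ℤ (i ℤ.+ + suc n)        ≡⟨ P.cong (x ^ℤ_) (ℤP.+-assoc i (+ 1) (+ n)) ⟨
      x ^ℤ ((i ℤ.+ + 1) ℤ.+ + n)  ≈⟨ ^ℤ-+ (i ℤ.+ + 1) n ⟩
      x ^ℤ (i ℤ.+ + 1) * x ^ℕ n   ≈⟨ *-congʳ (^ℤ-suc i) ⟩
      x ^ℤ i * x * x ^ℕ n         ≈⟨ *-assoc (x ^ℤ i) x (x ^ℕ n) ⟩
      x ^ℤ i * (x * x ^ℕ n)       ∎

  poch-cong : ∀ {x y b b′} k → x ≈ y → b ≈ b′ → poch x b k ≈ poch y b′ k
  poch-cong zero    x≈y b≈b′ = refl
  poch-cong (suc k) x≈y b≈b′ =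
    *-cong (poch-cong k x≈y b≈b′) (+-congˡ (-‿cong (*-cong x≈y (^ℕ-cong k b≈b′))))

  poch-suc : ∀ x b k → poch x b (suc k) ≈ (1# - x) * poch (x * b) b k
  poch-suc x b zero    = solve 1 (λ x → :1 :* (:1 :- x :* :1) := (:1 :- x) :* :1) refl x
  poch-suc x b (suc k) = begin
    poch x b (suc k) * (1# - x * (b * b ^ℕ k))             ≈⟨ *-congʳ (poch-suc x b k) ⟩
    (1# - x) * poch (x * b) b k * (1# - x * (b * b ^ℕ k))  ≈⟨ solve 4 (λ x b bᵏ P →
        (:1 :- x) :* P :* (:1 :- x :* (b :* bᵏ)) := (:1 :- x) :* (P :* (:1 :- x :* b :* bᵏ)))
        refl x b (b ^ℕ k) (poch (x * b) b k) ⟩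
    (1# - x) * poch (x * b) b (suc k)                      ∎

  poch-suc-≉0 : ∀ {x b} k → poch x b (suc k) ≉ 0# → (1# - x) * poch (x * b) b k ≉ 0#
  poch-suc-≉0 {x} {b} k ≉0 ≈0 = ≉0 (trans (poch-suc x b k) ≈0)

  poch-tail : ∀ {x b} k → poch x b (suc k) ≉ 0# → (1# - x) ⁻¹ * poch x b (suc k) ≈ poch (x * b) b k
  poch-tail {x} {b} k ≉0 = begin
    (1# - x) ⁻¹ * poch x b (suc k)               ≈⟨ *-congˡ (poch-suc x b k) ⟩
    (1# - x) ⁻¹ * ((1# - x) * poch (x * b) b k)  ≈⟨ *-assoc _ _ _ ⟨
    (1# - x) ⁻¹ * (1# - x) * poch (x * b) b k    ≈⟨ *-congʳ (inverseˡ (*≉0⇒≉0ˡ (poch-suc-≉0 k ≉0))) ⟩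
    1# * poch (x * b) b k                        ≈⟨ *-identityˡ _ ⟩
    poch (x * b) b k                             ∎

  poch-shift-difference : ∀ x b k →
    poch (x * b) b (suc k) - poch x b (suc k) ≈ x * (1# - b * b ^ℕ k) * poch (x * b) b k
  poch-shift-difference x b k = begin
    poch (x * b) b k * (1# - x * b * b ^ℕ k) - poch x b (suc k)
      ≈⟨ +-congˡ (-‿cong (poch-suc x b k)) ⟩
    poch (x * b) b k * (1# - x * b * b ^ℕ k) - (1# - x) * poch (x * b) b k
      ≈⟨ solve 4 (λ P x b bᵏ → P :* (:1 :- x :* b :* bᵏ) :- (:1 :- x) :* P := x :* (:1 :- b :* bᵏ) :* P)
                 refl (poch (x * b) b k) x b (b ^ℕ k) ⟩
    x * (1# - b * b ^ℕ k) * poch (x * b) b k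
      ∎

  poch-square : ∀ x b k → poch (x * x) (b * b) k ≈ poch x b k * poch (- x) b k
  poch-square x b zero    = sym (*-identityˡ 1#)
  poch-square x b (suc k) = begin
    poch (x * x) (b * b) k * (1# - x * x * (b * b) ^ℕ k)
      ≈⟨ *-cong (poch-square x b k) (+-congˡ (-‿cong (*-congˡ (^ℕ-distrib-* b b k)))) ⟩
    poch x b k * poch (- x) b k * (1# - x * x * (b ^ℕ k * b ^ℕ k))
      ≈⟨ solve 4 (λ P P⁻ x bᵏ → P :* P⁻ :* (:1 :- x :* x :* (bᵏ :* bᵏ))
                             := P :* (:1 :- x :* bᵏ) :* (P⁻ :* (:1 :- (:- x) :* bᵏ)))
                 refl (poch x b k) (poch (- x) b k) x (b ^ℕ k) ⟩
    poch x b (suc k) * poch (- x) b (suc k)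
      ∎

  poch-prefix-≉0 : ∀ {x b k n} → k ≤ n → poch x b n ≉ 0# → poch x b k ≉ 0#
  poch-prefix-≉0 = go ∘ ℕP.≤⇒≤′
    where
    go : ∀ {x b k n} → k ≤′ n → poch x b n ≉ 0# → poch x b k ≉ 0#
    go ≤′-refl        = id
    go (≤′-step k≤′n) = go k≤′n ∘ *≉0⇒≉0ˡ

  sumTo-cong : ∀ n {f g : ℕ → Carrier} → (∀ k → k ≤ n → f k ≈ g k) → sumTo n f ≈ sumTo n g
  sumTo-cong zero    f≈g = f≈g 0 ℕ.z≤n
  sumTo-cong (suc n) f≈g =
    +-cong (sumTo-cong n (λ k k≤n → f≈g k (ℕP.m≤n⇒m≤1+n k≤n))) (f≈g (suc n) ℕP.≤-refl)

  sumTo-sub-shifted : ∀ n (f g h : ℕ → Carrier) z → f 0 ≈ g 0 →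
    (∀ j → j ≤ n → f (suc j) ≈ g (suc j) - z * h j) →
    sumTo (suc n) f ≈ sumTo (suc n) g - z * sumTo n h
  sumTo-sub-shifted zero f g h z f0≈g0 f≈g-zh = begin
    f 0 + f 1              ≈⟨ +-cong f0≈g0 (f≈g-zh 0 ℕ.z≤n) ⟩
    g 0 + (g 1 - z * h 0)  ≈⟨ solve 4 (λ a b z c → a :+ (b :- z :* c) := a :+ b :- z :* c)
                                      refl (g 0) (g 1) z (h 0) ⟩
    g 0 + g 1 - z * h 0    ∎
  sumTo-sub-shifted (suc n) f g h z f0≈g0 f≈g-zh = begin
    sumTo (suc n) f + f (suc (suc n))
      ≈⟨ +-cong (sumTo-sub-shifted n f g h z f0≈g0 (λ j j≤n → f≈g-zh j (ℕP.m≤n⇒m≤1+n j≤n)))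
                (f≈g-zh (suc n) ℕP.≤-refl) ⟩
    (sumTo (suc n) g - z * sumTo n h) + (g (suc (suc n)) - z * h (suc n))
      ≈⟨ solve 5 (λ G H z g h → G :- z :* H :+ (g :- z :* h) := G :+ g :- z :* (H :+ h))
                 refl (sumTo (suc n) g) (sumTo n h) z (g (suc (suc n))) (h (suc n)) ⟩
    sumTo (suc n) g + g (suc (suc n)) - z * (sumTo n h + h (suc n))
      ∎

module BasicHypergeometric {c ℓ} (F : Field c ℓ) (q : Field.Carrier F) where
  open Field F
  open FieldProperties F
  open IntegerCoefficientRingSolver commutativeRing using (solve; _:=_; _:+_; _:*_; _:-_; :-_; :0; :1)
  open import Relation.Binary.Reasoning.Setoid setoid

  term : Carrier → Carrier → Carrier → Carrier → ℕ → Carrier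
  term A B C z k = poch A q k * poch B q k / (poch q q k * poch C q k) * z ^ℕ k

  φ : Carrier → Carrier → Carrier → Carrier → ℕ → Carrier
  φ A B C z n = sumTo n (term A B C z)

  -- ∏_{j<n} (b - c qʲ), which is (c/b; q)_n bⁿ when b ≉ 0
  hpoch : Carrier → Carrier → ℕ → Carrier
  hpoch b c zero    = 1#
  hpoch b c (suc n) = hpoch b c n * (b - c * q ^ℕ n)

  hpoch-scale : ∀ b c n → hpoch (b * q) (c * q) n ≈ q ^ℕ n * hpoch b c n
  hpoch-scale b c zero    = sym (*-identityˡ 1#)
  hpoch-scale b c (suc n) = begin
    hpoch (b * q) (c * q) n * (b * q - c * q * q ^ℕ n)  ≈⟨ *-congʳ (hpoch-scale b c n) ⟩
    q ^ℕ n * hpoch b c n * (b * q - c * q * q ^ℕ n)     ≈⟨ solve 5 (λ qⁿ H b c q →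
        qⁿ :* H :* (b :* q :- c :* q :* qⁿ) := q :* qⁿ :* (H :* (b :- c :* qⁿ)))
        refl (q ^ℕ n) (hpoch b c n) b c q ⟩
    q * q ^ℕ n * (hpoch b c n * (b - c * q ^ℕ n))       ∎

  hpoch-factor : ∀ {b d} c n → b * d ≈ 1# → hpoch b c n ≈ b ^ℕ n * poch (c * d) q n
  hpoch-factor         c zero    bd≈1 = sym (*-identityˡ 1#)
  hpoch-factor {b} {d} c (suc n) bd≈1 = begin
    hpoch b c n * (b - c * q ^ℕ n)
      ≈⟨ *-cong (hpoch-factor c n bd≈1) (+-congˡ (-‿cong (trans (sym (*-identityˡ _)) (*-congʳ (sym bd≈1))))) ⟩
    b ^ℕ n * poch (c * d) q n * (b - b * d * (c * q ^ℕ n))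
      ≈⟨ solve 6 (λ bⁿ P b d c qⁿ → bⁿ :* P :* (b :- b :* d :* (c :* qⁿ))
                                 := b :* bⁿ :* (P :* (:1 :- c :* d :* qⁿ)))
                 refl (b ^ℕ n) (poch (c * d) q n) b d c (q ^ℕ n) ⟩
    b * b ^ℕ n * (poch (c * d) q n * (1# - c * d * q ^ℕ n))
      ∎

  poch-q-q-≉0 : (∀ m → 1 ≤ m → q ^ℕ m ≉ 1#) → ∀ k → poch q q k ≉ 0#
  poch-q-q-≉0 qᵐ≉1 zero    = 1≉0
  poch-q-q-≉0 qᵐ≉1 (suc k) =
    *-≉0 (poch-q-q-≉0 qᵐ≉1 k) (λ u≈0 → qᵐ≉1 (suc k) (s≤s ℕ.z≤n) (sym (x∙y⁻¹≈ε⇒x≈y 1# _ u≈0)))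
    where open import Algebra.Properties.Group +-group using (x∙y⁻¹≈ε⇒x≈y)

  poch-ratio-suc : ∀ B C j → poch q q (suc j) ≉ 0# → poch C q (suc j) ≉ 0# →
    (1# - q * q ^ℕ j) * (poch B q (suc j) * (poch q q (suc j) * poch C q (suc j)) ⁻¹)
      ≈ (1# - B) * (1# - C) ⁻¹ * (poch (B * q) q j / (poch q q j * poch (C * q) q j))
  poch-ratio-suc B C j qq≉0 C≉0 = begin
    u * (poch B q (suc j) * (poch q q (suc j) * poch C q (suc j)) ⁻¹)
      ≈⟨ *-congˡ (*-cong (poch-suc B q j) (⁻¹-cong denominator)) ⟩
    u * ((1# - B) * poch (B * q) q j * (u * (1# - C) * D′) ⁻¹)
      ≈⟨ *-congˡ (*-congˡ (trans (⁻¹-distrib-* (*-≉0 u≉0 1-C≉0) D′≉0) (*-congʳ (⁻¹-distrib-* u≉0 1-C≉0)))) ⟩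
    u * ((1# - B) * poch (B * q) q j * (u ⁻¹ * (1# - C) ⁻¹ * D′ ⁻¹))
      ≈⟨ solve 6 (λ u u⁻¹ B P K D → u :* ((:1 :- B) :* P :* (u⁻¹ :* K :* D))
                                 := u :* u⁻¹ :* ((:1 :- B) :* K :* (P :* D)))
                 refl u (u ⁻¹) B (poch (B * q) q j) ((1# - C) ⁻¹) (D′ ⁻¹) ⟩
    u * u ⁻¹ * ((1# - B) * (1# - C) ⁻¹ * (poch (B * q) q j / D′))
      ≈⟨ trans (*-congʳ (inverseʳ u u≉0)) (*-identityˡ _) ⟩
    (1# - B) * (1# - C) ⁻¹ * (poch (B * q) q j / D′)
      ∎
    where
    u D′ : Carrier
    u  = 1# - q * q ^ℕ j
    D′ = poch q q j * poch (C * q) q j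
    u≉0 : u ≉ 0#
    u≉0 = *≉0⇒≉0ʳ qq≉0
    1-C≉0 : 1# - C ≉ 0#
    1-C≉0 = *≉0⇒≉0ˡ (poch-suc-≉0 j C≉0)
    D′≉0 : D′ ≉ 0#
    D′≉0 = *-≉0 (*≉0⇒≉0ˡ qq≉0) (*≉0⇒≉0ʳ (poch-suc-≉0 j C≉0))
    denominator : poch q q (suc j) * poch C q (suc j) ≈ u * (1# - C) * D′
    denominator = begin
      poch q q j * u * poch C q (suc j)               ≈⟨ *-congˡ (poch-suc C q j) ⟩
      poch q q j * u * ((1# - C) * poch (C * q) q j)  ≈⟨ solve 4 (λ Q u K P → Q :* u :* (K :* P) := u :* K :* (Q :* P))
                                                                 refl (poch q q j) u (1# - C) (poch (C * q) q j) ⟩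
      u * (1# - C) * D′                               ∎

  term-vanishes : ∀ {A} B C z n → A * q ^ℕ n ≈ 1# → term A B C z (suc n) ≈ 0#
  term-vanishes {A} B C z n Aqⁿ≈1 = begin
    poch A q n * (1# - A * q ^ℕ n) * poch B q (suc n) * D⁻¹ * z ^ℕ suc n
      ≈⟨ *-congʳ (*-congʳ (*-congʳ (*-congˡ (trans (+-congˡ (-‿cong Aqⁿ≈1)) (-‿inverseʳ 1#))))) ⟩
    poch A q n * 0# * poch B q (suc n) * D⁻¹ * z ^ℕ suc n
      ≈⟨ solve 4 (λ P Q D Z → P :* :0 :* Q :* D :* Z := :0) refl (poch A q n) (poch B q (suc n)) D⁻¹ (z ^ℕ suc n) ⟩
    0#
      ∎
    where
    D⁻¹ : Carrier
    D⁻¹ = (poch q q (suc n) * poch C q (suc n)) ⁻¹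

  contiguous : ∀ A B C j → poch q q (suc j) ≉ 0# → poch C q (suc j) ≉ 0# →
    term A B C q (suc j)
      ≈ term (A * q) B C q (suc j) - A * q * (1# - B) * (1# - C) ⁻¹ * term (A * q) (B * q) (C * q) q j
  contiguous A B C j qq≉0 C≉0 = begin
    Pᴬ * Pᴮ * D⁻¹ * (q * q ^ℕ j)
      ≈⟨ solve 5 (λ Pᴬ Pᴬ′ Pᴮ D Z → Pᴬ :* Pᴮ :* D :* Z
                                 := Pᴬ′ :* Pᴮ :* D :* Z :- (Pᴬ′ :- Pᴬ) :* Pᴮ :* D :* Z)
                 refl Pᴬ (poch (A * q) q (suc j)) Pᴮ D⁻¹ (q * q ^ℕ j) ⟩
    term (A * q) B C q (suc j) - (poch (A * q) q (suc j) - Pᴬ) * Pᴮ * D⁻¹ * (q * q ^ℕ j)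
      ≈⟨ +-congˡ (-‿cong (*-congʳ (*-congʳ (*-congʳ (poch-shift-difference A q j))))) ⟩
    term (A * q) B C q (suc j) - A * u * P * Pᴮ * D⁻¹ * (q * q ^ℕ j)
      ≈⟨ +-congˡ (-‿cong (solve 7 (λ A u P Pᴮ D q qʲ → A :* u :* P :* Pᴮ :* D :* (q :* qʲ)
                                                    := A :* q :* P :* (u :* (Pᴮ :* D)) :* qʲ)
                                  refl A u P Pᴮ D⁻¹ q (q ^ℕ j))) ⟩
    term (A * q) B C q (suc j) - A * q * P * (u * (Pᴮ * D⁻¹)) * q ^ℕ j
      ≈⟨ +-congˡ (-‿cong (*-congʳ (*-congˡ (poch-ratio-suc B C j qq≉0 C≉0)))) ⟩
    term (A * q) B C q (suc j) - A * q * P * ((1# - B) * K * (Pᴮ′ / D′)) * q ^ℕ j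
      ≈⟨ +-congˡ (-‿cong (solve 8 (λ A q P B K Pᴮ′ D′⁻¹ qʲ →
                                      A :* q :* P :* ((:1 :- B) :* K :* (Pᴮ′ :* D′⁻¹)) :* qʲ
                                   := A :* q :* (:1 :- B) :* K :* (P :* Pᴮ′ :* D′⁻¹ :* qʲ))
                                  refl A q P B K Pᴮ′ (D′ ⁻¹) (q ^ℕ j))) ⟩
    term (A * q) B C q (suc j) - A * q * (1# - B) * K * term (A * q) (B * q) (C * q) q j
      ∎
    where
    u P Pᴬ Pᴮ Pᴮ′ K D⁻¹ D′ : Carrier
    u   = 1# - q * q ^ℕ j
    P   = poch (A * q) q j
    Pᴬ  = poch A q (suc j)
    Pᴮ  = poch B q (suc j)
    Pᴮ′ = poch (B * q) q j
    K   = (1# - C) ⁻¹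
    D⁻¹ = (poch q q (suc j) * poch C q (suc j)) ⁻¹
    D′  = poch q q j * poch (C * q) q j

  contiguous-q² : ∀ A B C j → poch q q (suc j) ≉ 0# → poch C q (suc j) ≉ 0# →
    term A B C (q * q) (suc j)
      ≈ term A B C q (suc j) - (1# - A) * (1# - B) * (1# - C) ⁻¹ * q * term (A * q) (B * q) (C * q) q j
  contiguous-q² A B C j qq≉0 C≉0 = begin
    Pᴬ * Pᴮ * D⁻¹ * (q * q) ^ℕ suc j
      ≈⟨ *-congˡ (^ℕ-distrib-* q q (suc j)) ⟩
    Pᴬ * Pᴮ * D⁻¹ * (Q * Q)
      ≈⟨ solve 4 (λ Pᴬ Pᴮ D Q → Pᴬ :* Pᴮ :* D :* (Q :* Q)
                             := Pᴬ :* Pᴮ :* D :* Q :- Pᴬ :* ((:1 :- Q) :* (Pᴮ :* D)) :* Q)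
                 refl Pᴬ Pᴮ D⁻¹ Q ⟩
    term A B C q (suc j) - Pᴬ * ((1# - Q) * (Pᴮ * D⁻¹)) * Q
      ≈⟨ +-congˡ (-‿cong (*-congʳ (*-cong (poch-suc A q j) (poch-ratio-suc B C j qq≉0 C≉0)))) ⟩
    term A B C q (suc j) - (1# - A) * P * ((1# - B) * K * (Pᴮ′ / D′)) * Q
      ≈⟨ +-congˡ (-‿cong (solve 8 (λ A P B K Pᴮ′ D′⁻¹ q qʲ →
                                      (:1 :- A) :* P :* ((:1 :- B) :* K :* (Pᴮ′ :* D′⁻¹)) :* (q :* qʲ)
                                   := (:1 :- A) :* (:1 :- B) :* K :* q :* (P :* Pᴮ′ :* D′⁻¹ :* qʲ))
                                  refl A P B K Pᴮ′ (D′ ⁻¹) q (q ^ℕ j))) ⟩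
    term A B C q (suc j) - (1# - A) * (1# - B) * K * q * term (A * q) (B * q) (C * q) q j
      ∎
    where
    Q P Pᴬ Pᴮ Pᴮ′ K D⁻¹ D′ : Carrier
    Q   = q ^ℕ suc j
    P   = poch (A * q) q j
    Pᴬ  = poch A q (suc j)
    Pᴮ  = poch B q (suc j)
    Pᴮ′ = poch (B * q) q j
    K   = (1# - C) ⁻¹
    D⁻¹ = (poch q q (suc j) * poch C q (suc j)) ⁻¹
    D′  = poch q q j * poch (C * q) q j

  q-Chu-Vandermonde : ∀ n {A B C} → A * q ^ℕ n ≈ 1# → poch q q n ≉ 0# → poch C q n ≉ 0# →
    φ A B C q n * poch C q n ≈ hpoch B C n
  q-Chu-Vandermonde zero _ _ _ = begin
    1# * 1# * (1# * 1#) ⁻¹ * 1# * 1#  ≈⟨ *-congʳ (*-congʳ (*-congˡ (trans (⁻¹-cong (*-identityˡ 1#)) 1⁻¹≈1))) ⟩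
    1# * 1# * 1# * 1# * 1#            ≈⟨ solve 0 (:1 :* :1 :* :1 :* :1 :* :1 := :1) refl ⟩
    1#                                ∎
  q-Chu-Vandermonde (suc n) {A} {B} {C} Aqⁿ⁺¹≈1 qq≉0 C≉0 = begin
    φ A B C q (suc n) * poch C q (suc n)
      ≈⟨ *-congʳ (sumTo-sub-shifted n (term A B C q) (term (A * q) B C q) (term (A * q) (B * q) C′ q) κ refl
           (λ j j≤n → contiguous A B C j (poch-prefix-≉0 (s≤s j≤n) qq≉0) (poch-prefix-≉0 (s≤s j≤n) C≉0))) ⟩
    (Φ + term (A * q) B C q (suc n) - κ * Φ′) * poch C q (suc n)
      ≈⟨ *-congʳ (+-congʳ (+-congˡ (term-vanishes B C q n Aq·qⁿ≈1))) ⟩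
    (Φ + 0# - κ * Φ′) * (poch C q n * v)
      ≈⟨ solve 8 (λ Φ Φ′ D v A q B K → (Φ :+ :0 :- A :* q :* (:1 :- B) :* K :* Φ′) :* (D :* v)
                                    := Φ :* D :* v :- A :* q :* (:1 :- B) :* Φ′ :* (K :* (D :* v)))
                 refl Φ Φ′ (poch C q n) v A q B K ⟩
    Φ * poch C q n * v - A * q * (1# - B) * Φ′ * (K * poch C q (suc n))
      ≈⟨ +-cong (*-congʳ (q-Chu-Vandermonde n Aq·qⁿ≈1 qq≉0′ (*≉0⇒≉0ˡ C≉0)))
                (-‿cong (*-congˡ (poch-tail n C≉0))) ⟩
    hpoch B C n * v - A * q * (1# - B) * Φ′ * poch C′ q n
      ≈⟨ +-congˡ (-‿cong (trans (*-assoc _ Φ′ _) (*-congˡ (trans (q-Chu-Vandermonde n Aq·qⁿ≈1 qq≉0′ C′≉0)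
                                                                  (hpoch-scale B C n))))) ⟩
    hpoch B C n * v - A * q * (1# - B) * (q ^ℕ n * hpoch B C n)
      ≈⟨ solve 6 (λ H C qⁿ A q B → H :* (:1 :- C :* qⁿ) :- A :* q :* (:1 :- B) :* (qⁿ :* H)
                                := H :* (:1 :- C :* qⁿ :- A :* (q :* qⁿ) :* (:1 :- B)))
                 refl (hpoch B C n) C (q ^ℕ n) A q B ⟩
    hpoch B C n * (v - A * (q * q ^ℕ n) * (1# - B))
      ≈⟨ *-congˡ (+-congˡ (-‿cong (trans (*-congʳ Aqⁿ⁺¹≈1) (*-identityˡ _)))) ⟩
    hpoch B C n * (v - (1# - B))
      ≈⟨ *-congˡ (solve 3 (λ B C qⁿ → :1 :- C :* qⁿ :- (:1 :- B) := B :- C :* qⁿ) refl B C (q ^ℕ n)) ⟩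
    hpoch B C (suc n)
      ∎
    where
    C′ K κ v Φ Φ′ : Carrier
    C′ = C * q
    K  = (1# - C) ⁻¹
    κ  = A * q * (1# - B) * K
    v  = 1# - C * q ^ℕ n
    Φ  = φ (A * q) B C q n
    Φ′ = φ (A * q) (B * q) C′ q n
    Aq·qⁿ≈1 : A * q * q ^ℕ n ≈ 1#
    Aq·qⁿ≈1 = trans (*-assoc A q (q ^ℕ n)) Aqⁿ⁺¹≈1
    qq≉0′ : poch q q n ≉ 0#
    qq≉0′ = *≉0⇒≉0ˡ qq≉0
    C′≉0 : poch C′ q n ≉ 0#
    C′≉0 = *≉0⇒≉0ʳ (poch-suc-≉0 n C≉0)

  q-Chu-Vandermonde-q² : ∀ m {A B C} → A * q ^ℕ suc m ≈ 1# → poch q q (suc m) ≉ 0# → poch C q (suc m) ≉ 0# →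
    φ A B C (q * q) (suc m) * poch C q (suc m) ≈ hpoch B C m * (1# - q ^ℕ suc m + B * q ^ℕ suc m - C * q ^ℕ m)
  q-Chu-Vandermonde-q² m {A} {B} {C} Aqᵐ⁺¹≈1 qq≉0 C≉0 = begin
    φ A B C (q * q) (suc m) * poch C q (suc m)
      ≈⟨ *-congʳ (sumTo-sub-shifted m (term A B C (q * q)) (term A B C q) (term (A * q) (B * q) C′ q) κ refl
           (λ j j≤m → contiguous-q² A B C j (poch-prefix-≉0 (s≤s j≤m) qq≉0) (poch-prefix-≉0 (s≤s j≤m) C≉0))) ⟩
    (φ A B C q (suc m) - κ * Φ′) * poch C q (suc m)
      ≈⟨ solve 7 (λ Φ Φ′ D A B K q → (Φ :- (:1 :- A) :* (:1 :- B) :* K :* q :* Φ′) :* D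
                                  := Φ :* D :- (:1 :- A) :* (:1 :- B) :* q :* Φ′ :* (K :* D))
                 refl (φ A B C q (suc m)) Φ′ (poch C q (suc m)) A B K q ⟩
    φ A B C q (suc m) * poch C q (suc m) - (1# - A) * (1# - B) * q * Φ′ * (K * poch C q (suc m))
      ≈⟨ +-cong (q-Chu-Vandermonde (suc m) Aqᵐ⁺¹≈1 qq≉0 C≉0)
                (-‿cong (trans (*-congˡ (poch-tail m C≉0)) (*-assoc _ Φ′ _))) ⟩
    hpoch B C (suc m) - (1# - A) * (1# - B) * q * (Φ′ * poch C′ q m)
      ≈⟨ +-congˡ (-‿cong (*-congˡ (trans (q-Chu-Vandermonde m Aq·qᵐ≈1 (*≉0⇒≉0ˡ qq≉0) C′≉0)
                                         (hpoch-scale B C m)))) ⟩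
    hpoch B C m * (B - C * q ^ℕ m) - (1# - A) * (1# - B) * q * (q ^ℕ m * hpoch B C m)
      ≈⟨ solve 6 (λ H B C qᵐ A q → H :* (B :- C :* qᵐ) :- (:1 :- A) :* (:1 :- B) :* q :* (qᵐ :* H)
                                := H :* (B :- C :* qᵐ :- (:1 :- B) :* (q :* qᵐ :- A :* (q :* qᵐ))))
                 refl (hpoch B C m) B C (q ^ℕ m) A q ⟩
    hpoch B C m * (B - C * q ^ℕ m - (1# - B) * (q ^ℕ suc m - A * q ^ℕ suc m))
      ≈⟨ *-congˡ (+-congˡ (-‿cong (*-congˡ (+-congˡ (-‿cong Aqᵐ⁺¹≈1))))) ⟩
    hpoch B C m * (B - C * q ^ℕ m - (1# - B) * (q ^ℕ suc m - 1#))
      ≈⟨ *-congˡ (solve 4 (λ B C qᵐ N → B :- C :* qᵐ :- (:1 :- B) :* (N :- :1) := :1 :- N :+ B :* N :- C :* qᵐ)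
                          refl B C (q ^ℕ m) (q ^ℕ suc m)) ⟩
    hpoch B C m * (1# - q ^ℕ suc m + B * q ^ℕ suc m - C * q ^ℕ m)
      ∎
    where
    C′ K κ Φ′ : Carrier
    C′ = C * q
    K  = (1# - C) ⁻¹
    κ  = (1# - A) * (1# - B) * K * q
    Φ′ = φ (A * q) (B * q) C′ q m
    Aq·qᵐ≈1 : A * q * q ^ℕ m ≈ 1#
    Aq·qᵐ≈1 = trans (*-assoc A q (q ^ℕ m)) Aqᵐ⁺¹≈1
    C′≉0 : poch C′ q m ≉ 0#
    C′≉0 = *≉0⇒≉0ʳ (poch-suc-≉0 m C≉0)

  φ-at-−A : ∀ n {A C M} → A * q ^ℕ n ≈ 1# → C * q ^ℕ n ≈ M → poch q q n ≉ 0# → poch C q n ≉ 0# →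
    φ A (- A) C q n ≈ poch (- M) q n / poch C q n * (- 1#) ^ℕ n * A ^ℕ n
  φ-at-−A n {A} {C} {M} Aqⁿ≈1 Cqⁿ≈M qq≉0 C≉0 = begin
    φ A (- A) C q n
      ≈⟨ *≈⇒≈/ C≉0 (q-Chu-Vandermonde n Aqⁿ≈1 qq≉0 C≉0) ⟩
    hpoch (- A) C n / poch C q n
      ≈⟨ *-congʳ (hpoch-factor C n (trans (solve 2 (λ A Q → :- A :* :- Q := A :* Q) refl A (q ^ℕ n)) Aqⁿ≈1)) ⟩
    (- A) ^ℕ n * poch (C * - q ^ℕ n) q n / poch C q n
      ≈⟨ *-congʳ (*-cong (trans (^ℕ-cong n (solve 1 (λ A → :- A := :- :1 :* A) refl A)) (^ℕ-distrib-* (- 1#) A n))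
                         (poch-cong n (trans (solve 2 (λ C Q → C :* :- Q := :- (C :* Q)) refl C (q ^ℕ n))
                                             (-‿cong Cqⁿ≈M))
                                      refl)) ⟩
    (- 1#) ^ℕ n * A ^ℕ n * poch (- M) q n / poch C q n
      ≈⟨ solve 4 (λ s Aⁿ P D → s :* Aⁿ :* P :* D := P :* D :* s :* Aⁿ)
                 refl ((- 1#) ^ℕ n) (A ^ℕ n) (poch (- M) q n) (poch C q n ⁻¹) ⟩
    poch (- M) q n / poch C q n * (- 1#) ^ℕ n * A ^ℕ n
      ∎

  φ-q²-at-−A : ∀ n {A C a} → q ≉ 0# → A * q ^ℕ n ≈ 1# → C * q ^ℕ n ≈ a * q →
    poch q q n ≉ 0# → poch C q n ≉ 0# → 1# + a * q ^ℕ n ≉ 0# →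
    φ A (- A) C (q * q) n ≈ (q ^ℕ n + a) / (1# + a * q ^ℕ n) * φ A (- A) C q n * q ^ℕ n
  φ-q²-at-−A zero {A} {C} {a} _ _ _ _ _ 1+a≉0 = sym (begin
    (1# + a) * W * t * 1#       ≈⟨ *-congʳ (*-congʳ (*-congʳ (+-congˡ (sym (*-identityʳ a))))) ⟩
    (1# + a * 1#) * W * t * 1#  ≈⟨ *-congʳ (*-congʳ (inverseʳ _ 1+a≉0)) ⟩
    1# * t * 1#                 ≈⟨ solve 1 (λ t → :1 :* t :* :1 := t) refl t ⟩
    t                           ∎)
    where
    W t : Carrier
    W = (1# + a * 1#) ⁻¹
    t = term A (- A) C q 0
  φ-q²-at-−A (suc m) {A} {C} {a} q≉0 Aqᵐ⁺¹≈1 Cqᵐ⁺¹≈aq qq≉0 C≉0 1+aN≉0 =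
    *-cancelʳ C≉0 (trans left (sym right))
    where
    N H W : Carrier
    N = q ^ℕ suc m
    H = hpoch (- A) C m
    W = (1# + a * N) ⁻¹
    Cqᵐ≈a : C * q ^ℕ m ≈ a
    Cqᵐ≈a = *-cancelʳ q≉0 (trans (solve 3 (λ C qᵐ q → C :* qᵐ :* q := C :* (q :* qᵐ)) refl C (q ^ℕ m) q) Cqᵐ⁺¹≈aq)
    left : φ A (- A) C (q * q) (suc m) * poch C q (suc m) ≈ - (N + a) * H
    left = begin
      φ A (- A) C (q * q) (suc m) * poch C q (suc m)  ≈⟨ q-Chu-Vandermonde-q² m Aqᵐ⁺¹≈1 qq≉0 C≉0 ⟩
      H * (1# - N + - A * N - C * q ^ℕ m)             ≈⟨ solve 4 (λ H N A Cqᵐ →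
          H :* (:1 :- N :+ :- A :* N :- Cqᵐ) := H :* (:1 :- N :- Cqᵐ) :- A :* N :* H) refl H N A (C * q ^ℕ m) ⟩
      H * (1# - N - C * q ^ℕ m) - A * N * H           ≈⟨ +-cong (*-congˡ (+-congˡ (-‿cong Cqᵐ≈a)))
                                                                (-‿cong (trans (*-congʳ Aqᵐ⁺¹≈1) (*-identityˡ H))) ⟩
      H * (1# - N - a) - H                            ≈⟨ solve 3 (λ H N a → H :* (:1 :- N :- a) :- H := :- (N :+ a) :* H)
                                                                 refl H N a ⟩
      - (N + a) * H                                   ∎
    right : (N + a) * W * φ A (- A) C q (suc m) * N * poch C q (suc m) ≈ - (N + a) * H
    right = begin
      (N + a) * W * φ A (- A) C q (suc m) * N * poch C q (suc m)
        ≈⟨ solve 5 (λ X W Φ N D → X :* W :* Φ :* N :* D := X :* W :* (Φ :* D) :* N)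
                   refl (N + a) W (φ A (- A) C q (suc m)) N (poch C q (suc m)) ⟩
      (N + a) * W * (φ A (- A) C q (suc m) * poch C q (suc m)) * N
        ≈⟨ *-congʳ (*-congˡ (trans (q-Chu-Vandermonde (suc m) Aqᵐ⁺¹≈1 qq≉0 C≉0)
                                   (*-congˡ (+-congˡ (-‿cong Cqᵐ≈a))))) ⟩
      (N + a) * W * (H * (- A - a)) * N
        ≈⟨ solve 5 (λ N a H A W → (N :+ a) :* W :* (H :* (:- A :- a)) :* N := :- (N :+ a) :* H :* ((A :* N :+ a :* N) :* W))
                   refl N a H A W ⟩
      - (N + a) * H * ((A * N + a * N) * W)
        ≈⟨ *-congˡ (trans (*-congʳ (+-congʳ Aqᵐ⁺¹≈1)) (inverseʳ _ 1+aN≉0)) ⟩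
      - (N + a) * H * 1#
        ≈⟨ *-identityʳ _ ⟩
      - (N + a) * H
        ∎

module TAsHypergeometric {c ℓ} (F : Field c ℓ) {q : Field.Carrier F} (q≉0 : Field._≉_ F q (Field.0# F))
                         (n : ℕ) (r : ℤ) where
  open Field F
  open FieldProperties F
  open BasicHypergeometric F q
  open import Relation.Binary.Reasoning.Setoid setoid
  open import Algebra.Properties.AbelianGroup ℤP.+-0-abelianGroup using (//-rightDividesˡ)

  A C : Carrier
  A = (q ⁻¹) ^ℕ n
  C = q ^ℤ (+ 1 ℤ.+ r ℤ.- + n)

  Aqⁿ≈1 : A * q ^ℕ n ≈ 1#
  Aqⁿ≈1 = ^ℕ-inverse n (inverseˡ q≉0)

  Cqⁿ≈q¹⁺ʳ : C * q ^ℕ n ≈ q ^ℤ (+ 1 ℤ.+ r)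
  Cqⁿ≈q¹⁺ʳ = trans (sym (^ℤ-+ q≉0 (+ 1 ℤ.+ r ℤ.- + n) n))
                   (reflexive (P.cong (q ^ℤ_) (//-rightDividesˡ (+ n) (+ 1 ℤ.+ r))))

  q¹⁺ʳ≈qʳq : q ^ℤ (+ 1 ℤ.+ r) ≈ q ^ℤ r * q
  q¹⁺ʳ≈qʳq = trans (reflexive (P.cong (q ^ℤ_) (ℤP.+-comm (+ 1) r))) (^ℤ-suc q≉0 r)

  Aⁿ≈q^-n² : A ^ℕ n ≈ q ^ℤ (ℤ.- (+ n ℤ.* + n))
  Aⁿ≈q^-n² = begin
    A ^ℕ n                         ≈⟨ ^ℕ-assocʳ (q ⁻¹) n n ⟩
    (q ⁻¹) ^ℕ (n ℕ.* n)            ≡⟨ ^ℤ-neg q (n ℕ.* n) ⟨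
    q ^ℤ (ℤ.- + (n ℕ.* n))         ≡⟨ P.cong (λ i → q ^ℤ (ℤ.- i)) (ℤP.pos-* n n) ⟩
    q ^ℤ (ℤ.- (+ n ℤ.* + n))       ∎

  q^-2n≈A² : q ^ℤ (ℤ.- (+ 2 ℤ.* + n)) ≈ A * A
  q^-2n≈A² = begin
    q ^ℤ (ℤ.- (+ 2 ℤ.* + n))       ≡⟨ P.cong (λ i → q ^ℤ (ℤ.- i)) (ℤP.pos-* 2 n) ⟨
    q ^ℤ (ℤ.- + (2 ℕ.* n))         ≡⟨ ^ℤ-neg q (2 ℕ.* n) ⟩
    (q ⁻¹) ^ℕ (2 ℕ.* n)            ≈⟨ ^ℕ-double (q ⁻¹) n ⟩
    A * A                          ∎

  T≈φ : ∀ s {z} → (∀ k → q ^ℤ ((+ 2 ℤ.- s) ℤ.* + k) ≈ z ^ℕ k) → T F q r n s ≈ φ A (- A) C z n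
  T≈φ s qᵏ≈zᵏ = sumTo-cong n (λ k _ → *-cong (*-congʳ (numerator k)) (qᵏ≈zᵏ k))
    where
    numerator : ∀ k → poch (q ^ℤ (ℤ.- (+ 2 ℤ.* + n))) (q ^ℕ 2) k ≈ poch A q k * poch (- A) q k
    numerator k = trans (poch-cong k q^-2n≈A² (*-congˡ (*-identityʳ q))) (poch-square A q k)

  T₁≈φ : T F q r n (+ 1) ≈ φ A (- A) C q n
  T₁≈φ = T≈φ (+ 1) (λ k → reflexive (P.cong (q ^ℤ_) (ℤP.*-identityˡ (+ k))))

  T₀≈φ : T F q r n (+ 0) ≈ φ A (- A) C (q * q) n
  T₀≈φ = T≈φ (+ 0) (λ k → begin
    q ^ℤ (+ 2 ℤ.* + k)  ≡⟨ P.cong (q ^ℤ_) (ℤP.pos-* 2 k) ⟨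
    q ^ℕ (2 ℕ.* k)      ≈⟨ ^ℕ-double q k ⟩
    q ^ℕ k * q ^ℕ k     ≈⟨ ^ℕ-distrib-* q q k ⟨
    (q * q) ^ℕ k        ∎)

lemma2p3 : ∀ {c ℓ} (F : Field c ℓ) → let open Field F in
    (q : Carrier) → ¬ (q ≈ 0#) → (∀ m → 1 ≤ m → ¬ (q ^ℕ m ≈ 1#)) →
    (n : ℕ) (r : ℤ) →
    ¬ (poch (q ^ℤ (+ 1 ℤ.+ r ℤ.- + n)) q n ≈ 0#) →
    ¬ (1# + q ^ℤ (r ℤ.+ + n) ≈ 0#) →
    (T F q r n (+ 1) ≈
       poch (- (q ^ℤ (+ 1 ℤ.+ r))) q n / poch (q ^ℤ (+ 1 ℤ.+ r ℤ.- + n)) q n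
         * (- 1#) ^ℕ n * q ^ℤ (ℤ.- (+ n ℤ.* + n)))
    × (T F q r n (+ 0) ≈
       (q ^ℕ n + q ^ℤ r) / (1# + q ^ℤ (r ℤ.+ + n))
         * (poch (- (q ^ℤ (+ 1 ℤ.+ r))) q n / poch (q ^ℤ (+ 1 ℤ.+ r ℤ.- + n)) q n)
         * (- 1#) ^ℕ n * q ^ℤ (ℤ.- (+ n ℤ.* + n) ℤ.+ + n))
lemma2p3 F q q≉0 qᵐ≉1 n r C≉0 1+qʳ⁺ⁿ≉0 = T₁≈ , T₀≈
  where
  open Field F
  open FieldProperties F
  open BasicHypergeometric F q
  open TAsHypergeometric F q≉0 n r
  open IntegerCoefficientRingSolver commutativeRing using (solve; _:=_; _:*_)
  open import Relation.Binary.Reasoning.Setoid setoid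

  P X q^-n² : Carrier
  P     = poch (- (q ^ℤ (+ 1 ℤ.+ r))) q n
  X     = (q ^ℕ n + q ^ℤ r) / (1# + q ^ℤ (r ℤ.+ + n))
  q^-n² = q ^ℤ (ℤ.- (+ n ℤ.* + n))

  qʳqⁿ≈qʳ⁺ⁿ : q ^ℤ r * q ^ℕ n ≈ q ^ℤ (r ℤ.+ + n)
  qʳqⁿ≈qʳ⁺ⁿ = sym (^ℤ-+ q≉0 r n)

  φ≈ : φ A (- A) C q n ≈ P / poch C q n * (- 1#) ^ℕ n * q^-n²
  φ≈ = trans (φ-at-−A n Aqⁿ≈1 Cqⁿ≈q¹⁺ʳ (poch-q-q-≉0 qᵐ≉1 n) C≉0) (*-congˡ Aⁿ≈q^-n²)

  T₁≈ : T F q r n (+ 1) ≈ P / poch C q n * (- 1#) ^ℕ n * q^-n²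
  T₁≈ = trans T₁≈φ φ≈

  T₀≈ : T F q r n (+ 0) ≈ X * (P / poch C q n) * (- 1#) ^ℕ n * q ^ℤ (ℤ.- (+ n ℤ.* + n) ℤ.+ + n)
  T₀≈ = begin
    T F q r n (+ 0)
      ≈⟨ trans T₀≈φ (φ-q²-at-−A n q≉0 Aqⁿ≈1 (trans Cqⁿ≈q¹⁺ʳ q¹⁺ʳ≈qʳq) (poch-q-q-≉0 qᵐ≉1 n) C≉0
                                (1+qʳ⁺ⁿ≉0 ∘ trans (+-congˡ (sym qʳqⁿ≈qʳ⁺ⁿ)))) ⟩
    (q ^ℕ n + q ^ℤ r) / (1# + q ^ℤ r * q ^ℕ n) * φ A (- A) C q n * q ^ℕ n
      ≈⟨ *-congʳ (*-cong (*-congˡ (⁻¹-cong (+-congˡ qʳqⁿ≈qʳ⁺ⁿ))) φ≈) ⟩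
    X * (P / poch C q n * (- 1#) ^ℕ n * q^-n²) * q ^ℕ n
      ≈⟨ solve 6 (λ X P D s Z N → X :* (P :* D :* s :* Z) :* N := X :* (P :* D) :* s :* (Z :* N))
                 refl X P (poch C q n ⁻¹) ((- 1#) ^ℕ n) q^-n² (q ^ℕ n) ⟩
    X * (P / poch C q n) * (- 1#) ^ℕ n * (q^-n² * q ^ℕ n)
      ≈⟨ *-congˡ (sym (^ℤ-+ q≉0 (ℤ.- (+ n ℤ.* + n)) n)) ⟩
    X * (P / poch C q n) * (- 1#) ^ℕ n * q ^ℤ (ℤ.- (+ n ℤ.* + n) ℤ.+ + n)
      ∎
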